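{- Let $G$ be the downward 4-cycle with vertices $t,s_1,s_2,b$ and edges $t\to s_1$, $t\to s_2$, $s_1\to b$, $s_2\to b$. A pebbling assignment $(S_G)$ on $G$ satisfies $G\cong[S_G]$ (as directed graphs) if and only if $t$ has $0$ or $1$ pebbles, each of $s_1$ and $s_2$ has $2$ or $3$ pebbles, and $b$ has an arbitrary number $n\ge 0$ of pebbles.
   Context: A pebbling assignment $(S_G)$ on $G$ assigns a nonnegative integer number of pebbles to each vertex. A pebbling move along an edge $(v,w)$ (allowed when $v$ has at least two pebbles) removes two pebbles from $v$ and adds one pebble to $w$. The assignment graph $[S_G]$ is the directed graph whose vertices are all assignments obtainable from $(S_G)$ by finite sequences of pebbling moves (including $(S_G)$ itself), with a directed edge from $A$ to $B$ whenever $B$ is obtained from $A$ by a single pebbling move. -}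

module Defs where

open import Data.Nat using (ℕ; suc; _∸_; _≤_)
open import Data.Fin using (Fin; zero; suc)
open import Data.Vec using (Vec; lookup; _[_]%=_)
open import Data.Product using (Σ; ∃; _×_)
open import Relation.Binary.PropositionalEquality using (_≡_)
open import Relation.Binary.Construct.Closure.ReflexiveTransitive using (Star)
open import Function.Bundles using (_⇔_)

Digraph : ℕ → Set₁
Digraph n = Fin n → Fin n → Set

Assignment : ℕ → Set
Assignment n = Vec ℕ n

data Move {n : ℕ} (E : Digraph n) (A : Assignment n) : Assignment n → Set where
  move : (v w : Fin n) → E v w → 2 ≤ lookup A v →
         Move E A ((A [ v ]%= (λ k → k ∸ 2)) [ w ]%= suc)

-- Assignments obtainable from S by a finite sequence of pebbling moves
-- (vertex set of the assignment graph [S_G]).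
Reachable : {n : ℕ} → Digraph n → Assignment n → Assignment n → Set
Reachable E S B = Star (Move E) S B

-- G ≅ [S_G] as directed graphs: a bijection f from the vertices of G onto the
-- vertices of [S_G] (the reachable assignments) with
-- E u v  ⇔  there is an edge f u → f v in [S_G].
IsoToAssignmentGraph : {n : ℕ} → Digraph n → Assignment n → Set
IsoToAssignmentGraph {n} E S =
  Σ (Fin n → Assignment n) λ f →
      (∀ v → Reachable E S (f v))
    × (∀ u v → f u ≡ f v → u ≡ v)
    × (∀ B → Reachable E S B → ∃ λ v → f v ≡ B)
    × (∀ u v → E u v ⇔ Move E (f u) (f v))

t s₁ s₂ b : Fin 4
t  = zero
s₁ = suc zero
s₂ = suc (suc zero)
b  = suc (suc (suc zero))

data Down4 : Digraph 4 where
  t→s₁ : Down4 t s₁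
  t→s₂ : Down4 t s₂
  s₁→b : Down4 s₁ b
  s₂→b : Down4 s₂ b

-- A move loses one pebble, so nothing reachable moves back to S: S is the image
-- of the source t, it has exactly two successors, and every move out of either
-- successor reaches one common assignment. Two pebbles on t would give S a third
-- successor (if s₁ or s₂ is loaded) or two different continuations; at most one
-- pebble on s₁ leaves s₂→b as the only move from S; four pebbles on s₁, with s₂
-- loaded, allow two different second moves. Conversely, if t ≤ 1 and
-- s₁, s₂ ∈ {2, 3}, then s₁→b and s₂→b can each fire exactly once, and the four
-- resulting assignments form the diamond.
module Submission where

open import Defs
open import Data.Nat using (ℕ; suc; _+_; _∸_; _≤_; _<_; _≤?_; z≤n; s≤s)
open import Data.Nat.Properties
  using (+-assoc; +-suc; +-commutativeSemigroup; m+[n∸m]≡n; ≤-refl; ≤-trans; ≤-reflexive; n≤1+n; <⇒≱; ≰⇒>)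
open import Algebra.Properties.CommutativeSemigroup +-commutativeSemigroup using (x∙yz≈y∙xz)
open import Data.Fin using (Fin; zero; suc)
open import Data.Vec using (Vec; []; _∷_; lookup; sum; _[_]%=_)
open import Data.Product using (_×_; ∃; ∃-syntax; _,_; proj₁; proj₂; map₂)
open import Data.Sum using (_⊎_; inj₁; inj₂)
open import Data.Empty using (⊥; ⊥-elim)
open import Relation.Nullary using (¬_; yes; no)
open import Relation.Binary.PropositionalEquality using (_≡_; _≢_; refl; sym; trans; cong; subst)
open import Relation.Binary.Construct.Closure.ReflexiveTransitive using (ε; _◅_; _◅◅_)
open import Function.Base using (_∘_)
open import Function.Bundles using (_⇔_; mk⇔; Equivalence)

≤⊎> : ∀ m n → m ≤ n ⊎ n < m
≤⊎> m n with m ≤? n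
... | yes m≤n = inj₁ m≤n
... | no m≰n = inj₂ (≰⇒> m≰n)

sum-[]%=suc : ∀ {n} (A : Vec ℕ n) i → sum (A [ i ]%= suc) ≡ suc (sum A)
sum-[]%=suc (x ∷ A) zero = refl
sum-[]%=suc (x ∷ A) (suc i) = trans (cong (x +_) (sum-[]%=suc A i)) (+-suc x (sum A))

sum-[]%=∸ : ∀ {n} (A : Vec ℕ n) i {k} → k ≤ lookup A i → k + sum (A [ i ]%= (_∸ k)) ≡ sum A
sum-[]%=∸ (x ∷ A) zero {k} k≤x =
  trans (sym (+-assoc k (x ∸ k) (sum A))) (cong (_+ sum A) (m+[n∸m]≡n k≤x))
sum-[]%=∸ (x ∷ A) (suc i) {k} k≤Ai =
  trans (x∙yz≈y∙xz k x _) (cong (x +_) (sum-[]%=∸ A i k≤Ai))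

module _ {n} {E : Digraph n} where

  move-loses-one-pebble : ∀ {A B} → Move E A B → suc (sum B) ≡ sum A
  move-loses-one-pebble {A} (move v w _ 2≤Av) =
    trans (cong suc (sum-[]%=suc (A [ v ]%= (_∸ 2)) w)) (sum-[]%=∸ A v 2≤Av)

  reachable-sum-≤ : ∀ {A B} → Reachable E A B → sum B ≤ sum A
  reachable-sum-≤ ε = ≤-refl
  reachable-sum-≤ (m ◅ ms) =
    ≤-trans (reachable-sum-≤ ms) (≤-trans (n≤1+n _) (≤-reflexive (move-loses-one-pebble m)))

  image-closed-under-moves : (f : Fin n → Assignment n) →
    (∀ {u B} → Move E (f u) B → ∃[ v ] f v ≡ B) →
    ∀ {u B} → Reachable E (f u) B → ∃[ v ] f v ≡ B
  image-closed-under-moves f closed {u} ε = u , refl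
  image-closed-under-moves f closed (m ◅ ms) with closed m
  ... | _ , refl = image-closed-under-moves f closed ms

module AssignmentGraphIso {n} {E : Digraph n} {S : Assignment n} (iso : IsoToAssignmentGraph E S) where

  vertex : Fin n → Assignment n
  vertex = proj₁ iso

  reachable : ∀ v → Reachable E S (vertex v)
  reachable = proj₁ (proj₂ iso)

  injective : ∀ u v → vertex u ≡ vertex v → u ≡ v
  injective = proj₁ (proj₂ (proj₂ iso))

  surjective : ∀ B → Reachable E S B → ∃[ v ] vertex v ≡ B
  surjective = proj₁ (proj₂ (proj₂ (proj₂ iso)))

  edge⇒move : ∀ {u v} → E u v → Move E (vertex u) (vertex v)
  edge⇒move {u} {v} = Equivalence.to (proj₂ (proj₂ (proj₂ (proj₂ iso))) u v)

  move⇒edge : ∀ {u v} → Move E (vertex u) (vertex v) → E u v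
  move⇒edge {u} {v} = Equivalence.from (proj₂ (proj₂ (proj₂ (proj₂ iso))) u v)

  move-from-vertex : ∀ {u B} → Move E (vertex u) B → ∃[ v ] E u v × vertex v ≡ B
  move-from-vertex {u} m with surjective _ (reachable u ◅◅ m ◅ ε)
  ... | v , refl = v , move⇒edge m , refl

  root-is-source : ∀ {u v} → vertex v ≡ S → ¬ E u v
  root-is-source {u} vertex≡S e =
    <⇒≱ (≤-reflexive (move-loses-one-pebble (subst (Move E (vertex u)) vertex≡S (edge⇒move e))))
        (reachable-sum-≤ (reachable u))

-- Pattern versions of the vertices t, s₁, s₂, b, which Defs defines as functions.
pattern t′ = zero
pattern s₁′ = suc zero
pattern s₂′ = suc (suc zero)
pattern b′ = suc (suc (suc zero))

t-or-has-in-edge : ∀ v → v ≡ t ⊎ ∃[ u ] Down4 u v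
t-or-has-in-edge t′ = inj₁ refl
t-or-has-in-edge s₁′ = inj₂ (t , t→s₁)
t-or-has-in-edge s₂′ = inj₂ (t , t→s₂)
t-or-has-in-edge b′ = inj₂ (s₁ , s₁→b)

-- Move Down4 with both assignments in constructor form, so that matching on a
-- move exposes the pebble counts.
infix 4 _⟶_

data _⟶_ : Assignment 4 → Assignment 4 → Set where
  t⇒s₁ : ∀ {k y z w} → 2 + k ∷ y ∷ z ∷ w ∷ [] ⟶ k ∷ suc y ∷ z ∷ w ∷ []
  t⇒s₂ : ∀ {k y z w} → 2 + k ∷ y ∷ z ∷ w ∷ [] ⟶ k ∷ y ∷ suc z ∷ w ∷ []
  s₁⇒b : ∀ {x k z w} → x ∷ 2 + k ∷ z ∷ w ∷ [] ⟶ x ∷ k ∷ z ∷ suc w ∷ []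
  s₂⇒b : ∀ {x y k w} → x ∷ y ∷ 2 + k ∷ w ∷ [] ⟶ x ∷ y ∷ k ∷ suc w ∷ []

⟶⇒move : ∀ {A B} → A ⟶ B → Move Down4 A B
⟶⇒move t⇒s₁ = move t s₁ t→s₁ (s≤s (s≤s z≤n))
⟶⇒move t⇒s₂ = move t s₂ t→s₂ (s≤s (s≤s z≤n))
⟶⇒move s₁⇒b = move s₁ b s₁→b (s≤s (s≤s z≤n))
⟶⇒move s₂⇒b = move s₂ b s₂→b (s≤s (s≤s z≤n))

move⇒⟶ : ∀ {A B} → Move Down4 A B → A ⟶ B
move⇒⟶ {_ ∷ _ ∷ _ ∷ _ ∷ []} (move _ _ t→s₁ (s≤s (s≤s z≤n))) = t⇒s₁
move⇒⟶ {_ ∷ _ ∷ _ ∷ _ ∷ []} (move _ _ t→s₂ (s≤s (s≤s z≤n))) = t⇒s₂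
move⇒⟶ {_ ∷ _ ∷ _ ∷ _ ∷ []} (move _ _ s₁→b (s≤s (s≤s z≤n))) = s₁⇒b
move⇒⟶ {_ ∷ _ ∷ _ ∷ _ ∷ []} (move _ _ s₂→b (s≤s (s≤s z≤n))) = s₂⇒b

-- The first two layers of an assignment graph isomorphic to Down4; this is all
-- that the bounds on the pebble counts need.
record Down4Shaped (S : Assignment 4) : Set where
  field
    left right bottom : Assignment 4
    left≢right : left ≢ right
    S⟶left : S ⟶ left
    S⟶right : S ⟶ right
    successor : ∀ {B} → S ⟶ B → B ≡ left ⊎ B ≡ right
    successor-can-move : ∀ {B} → S ⟶ B → ∃ (B ⟶_)
    second-successor : ∀ {B C} → S ⟶ B → B ⟶ C → C ≡ bottom

  no-three-successors : ∀ {B₁ B₂ B₃} → S ⟶ B₁ → S ⟶ B₂ → S ⟶ B₃ →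
    B₁ ≢ B₂ → B₁ ≢ B₃ → B₂ ≢ B₃ → ⊥
  no-three-successors m₁ m₂ m₃ n₁₂ n₁₃ n₂₃ with successor m₁ | successor m₂ | successor m₃
  ... | inj₁ refl | inj₁ refl | _ = n₁₂ refl
  ... | inj₂ refl | inj₂ refl | _ = n₁₂ refl
  ... | _ | inj₁ refl | inj₁ refl = n₂₃ refl
  ... | _ | inj₂ refl | inj₂ refl = n₂₃ refl
  ... | inj₁ refl | _ | inj₁ refl = n₁₃ refl
  ... | inj₂ refl | _ | inj₂ refl = n₁₃ refl

  successor-moves-uniquely : ∀ {B C C′} → S ⟶ B → B ⟶ C → B ⟶ C′ → C ≡ C′
  successor-moves-uniquely m c c′ = trans (second-successor m c) (sym (second-successor m c′))

iso⇒down4Shaped : ∀ {S} → IsoToAssignmentGraph Down4 S → Down4Shaped S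
iso⇒down4Shaped {S} iso = record
  { left = vertex s₁
  ; right = vertex s₂
  ; bottom = vertex b
  ; left≢right = λ eq → s₁≢s₂ (injective s₁ s₂ eq)
  ; S⟶left = step-from-root t→s₁
  ; S⟶right = step-from-root t→s₂
  ; successor = successor
  ; successor-can-move = successor-can-move
  ; second-successor = second-successor
  }
  where
  open AssignmentGraphIso iso

  s₁≢s₂ : s₁ ≢ s₂
  s₁≢s₂ ()

  root : vertex t ≡ S
  root with surjective S ε
  ... | v , vertex≡S with t-or-has-in-edge v
  ...   | inj₁ refl = vertex≡S
  ...   | inj₂ (_ , e) = ⊥-elim (root-is-source vertex≡S e)

  step-from-root : ∀ {v} → Down4 t v → S ⟶ vertex v
  step-from-root e = move⇒⟶ (subst (λ A → Move Down4 A _) root (edge⇒move e))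

  side : ∀ {B} → S ⟶ B → ∃[ v ] Down4 t v × vertex v ≡ B
  side m = move-from-vertex (subst (λ A → Move Down4 A _) (sym root) (⟶⇒move m))

  successor : ∀ {B} → S ⟶ B → B ≡ vertex s₁ ⊎ B ≡ vertex s₂
  successor m with side m
  ... | _ , t→s₁ , refl = inj₁ refl
  ... | _ , t→s₂ , refl = inj₂ refl

  successor-can-move : ∀ {B} → S ⟶ B → ∃ (B ⟶_)
  successor-can-move m with side m
  ... | _ , t→s₁ , refl = vertex b , move⇒⟶ (edge⇒move s₁→b)
  ... | _ , t→s₂ , refl = vertex b , move⇒⟶ (edge⇒move s₂→b)

  second-successor : ∀ {B C} → S ⟶ B → B ⟶ C → C ≡ vertex b
  second-successor m m′ with side m
  ... | _ , e , refl with move-from-vertex (⟶⇒move m′) | e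
  ...   | _ , s₁→b , refl | t→s₁ = refl
  ...   | _ , s₂→b , refl | t→s₂ = refl

open Down4Shaped

only-s₁-fires : ∀ {x y z w C} → x ≤ 1 → z ≤ 1 → x ∷ y ∷ z ∷ w ∷ [] ⟶ C →
  ∃[ k ] y ≡ 2 + k × C ≡ x ∷ k ∷ z ∷ suc w ∷ []
only-s₁-fires (s≤s ()) _ t⇒s₁
only-s₁-fires (s≤s ()) _ t⇒s₂
only-s₁-fires _ _ s₁⇒b = _ , refl , refl
only-s₁-fires _ (s≤s ()) s₂⇒b

only-s₂-fires : ∀ {x y z w C} → x ≤ 1 → y ≤ 1 → x ∷ y ∷ z ∷ w ∷ [] ⟶ C →
  ∃[ k ] z ≡ 2 + k × C ≡ x ∷ y ∷ k ∷ suc w ∷ []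
only-s₂-fires (s≤s ()) _ t⇒s₁
only-s₂-fires (s≤s ()) _ t⇒s₂
only-s₂-fires _ (s≤s ()) s₁⇒b
only-s₂-fires _ _ s₂⇒b = _ , refl , refl

loaded-top-with-light-sides : ∀ {x y z w} → y ≤ 1 → z ≤ 1 → Down4Shaped (2 + x ∷ y ∷ z ∷ w ∷ []) → ⊥
loaded-top-with-light-sides {x} y≤1 z≤1 D with ≤⊎> x 1
... | inj₂ (s≤s (s≤s _)) with successor-moves-uniquely D t⇒s₁ t⇒s₁ t⇒s₂
...   | ()
loaded-top-with-light-sides {x} y≤1 z≤1 D | inj₁ x≤1
  with successor-can-move D t⇒s₁ | successor-can-move D t⇒s₂
... | _ , m₁ | _ , m₂ with only-s₁-fires x≤1 z≤1 m₁ | only-s₂-fires x≤1 y≤1 m₂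
...   | _ , refl , refl | _ , refl , refl
  with trans (second-successor D t⇒s₁ m₁) (sym (second-successor D t⇒s₂ m₂))
...     | ()

top-≤1 : ∀ {x y z w} → Down4Shaped (x ∷ y ∷ z ∷ w ∷ []) → x ≤ 1
top-≤1 {x} {y} {z} D with ≤⊎> x 1 | ≤⊎> y 1 | ≤⊎> z 1
... | inj₁ x≤1 | _ | _ = x≤1
... | inj₂ (s≤s (s≤s _)) | inj₂ (s≤s (s≤s _)) | _ =
  ⊥-elim (no-three-successors D t⇒s₁ t⇒s₂ s₁⇒b (λ ()) (λ ()) (λ ()))
... | inj₂ (s≤s (s≤s _)) | _ | inj₂ (s≤s (s≤s _)) =
  ⊥-elim (no-three-successors D t⇒s₁ t⇒s₂ s₂⇒b (λ ()) (λ ()) (λ ()))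
... | inj₂ (s≤s (s≤s _)) | inj₁ y≤1 | inj₁ z≤1 = ⊥-elim (loaded-top-with-light-sides y≤1 z≤1 D)

left-≥2 : ∀ {x y z w} → x ≤ 1 → Down4Shaped (x ∷ y ∷ z ∷ w ∷ []) → 2 ≤ y
left-≥2 {y = y} x≤1 D with ≤⊎> y 1
... | inj₂ 2≤y = 2≤y
... | inj₁ y≤1 with only-s₂-fires x≤1 y≤1 (S⟶left D) | only-s₂-fires x≤1 y≤1 (S⟶right D)
...   | _ , refl , left≡ | _ , refl , right≡ = ⊥-elim (left≢right D (trans left≡ (sym right≡)))

right-≥2 : ∀ {x y z w} → x ≤ 1 → Down4Shaped (x ∷ y ∷ z ∷ w ∷ []) → 2 ≤ z
right-≥2 {z = z} x≤1 D with ≤⊎> z 1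
... | inj₂ 2≤z = 2≤z
... | inj₁ z≤1 with only-s₁-fires x≤1 z≤1 (S⟶left D) | only-s₁-fires x≤1 z≤1 (S⟶right D)
...   | _ , refl , left≡ | _ , refl , right≡ = ⊥-elim (left≢right D (trans left≡ (sym right≡)))

left-≤3 : ∀ {x y z w} → 2 ≤ z → Down4Shaped (x ∷ y ∷ z ∷ w ∷ []) → y ≤ 3
left-≤3 {y = y} (s≤s (s≤s _)) D with ≤⊎> y 3
... | inj₁ y≤3 = y≤3
... | inj₂ (s≤s (s≤s (s≤s (s≤s _)))) with successor-moves-uniquely D s₁⇒b s₁⇒b s₂⇒b
...   | ()

right-≤3 : ∀ {x y z w} → 2 ≤ y → Down4Shaped (x ∷ y ∷ z ∷ w ∷ []) → z ≤ 3
right-≤3 {z = z} (s≤s (s≤s _)) D with ≤⊎> z 3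
... | inj₁ z≤3 = z≤3
... | inj₂ (s≤s (s≤s (s≤s (s≤s _)))) with successor-moves-uniquely D s₂⇒b s₂⇒b s₁⇒b
...   | ()

down4Shaped⇒bounds : ∀ {x y z w} → Down4Shaped (x ∷ y ∷ z ∷ w ∷ []) →
  x ≤ 1 × (2 ≤ y × y ≤ 3) × (2 ≤ z × z ≤ 3)
down4Shaped⇒bounds {x} {y} {z} D = x≤1 , (2≤y , left-≤3 2≤z D) , (2≤z , right-≤3 2≤y D)
  where
  x≤1 : x ≤ 1
  x≤1 = top-≤1 D
  2≤y : 2 ≤ y
  2≤y = left-≥2 x≤1 D
  2≤z : 2 ≤ z
  2≤z = right-≥2 x≤1 D

corner : ℕ → ℕ → ℕ → ℕ → Fin 4 → Assignment 4
corner x y z w t′ = x ∷ 2 + y ∷ 2 + z ∷ w ∷ []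
corner x y z w s₁′ = x ∷ y ∷ 2 + z ∷ 1 + w ∷ []
corner x y z w s₂′ = x ∷ 2 + y ∷ z ∷ 1 + w ∷ []
corner x y z w b′ = x ∷ y ∷ z ∷ 2 + w ∷ []

corner-injective : ∀ {x y z w} u v → corner x y z w u ≡ corner x y z w v → u ≡ v
corner-injective t′ t′ _ = refl
corner-injective s₁′ s₁′ _ = refl
corner-injective s₂′ s₂′ _ = refl
corner-injective b′ b′ _ = refl
corner-injective t′ s₁′ ()
corner-injective t′ s₂′ ()
corner-injective t′ b′ ()
corner-injective s₁′ t′ ()
corner-injective s₁′ s₂′ ()
corner-injective s₁′ b′ ()
corner-injective s₂′ t′ ()
corner-injective s₂′ s₁′ ()
corner-injective s₂′ b′ ()
corner-injective b′ t′ ()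
corner-injective b′ s₁′ ()
corner-injective b′ s₂′ ()

edge⇒corner-move : ∀ {x y z w u v} → Down4 u v → corner x y z w u ⟶ corner x y z w v
edge⇒corner-move t→s₁ = s₁⇒b
edge⇒corner-move t→s₂ = s₂⇒b
edge⇒corner-move s₁→b = s₂⇒b
edge⇒corner-move s₂→b = s₁⇒b

corner-move⇒edge : ∀ {x y z w B} → x ≤ 1 → y ≤ 1 → z ≤ 1 →
  ∀ u → corner x y z w u ⟶ B → ∃[ v ] Down4 u v × corner x y z w v ≡ B
corner-move⇒edge {x = suc (suc _)} (s≤s ()) _ _ _ _
corner-move⇒edge _ _ _ t′ s₁⇒b = s₁ , t→s₁ , refl
corner-move⇒edge _ _ _ t′ s₂⇒b = s₂ , t→s₂ , refl
corner-move⇒edge _ _ _ s₁′ s₂⇒b = b , s₁→b , refl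
corner-move⇒edge _ _ _ s₂′ s₁⇒b = b , s₂→b , refl
corner-move⇒edge _ (s≤s ()) _ s₁′ s₁⇒b
corner-move⇒edge _ _ (s≤s ()) s₂′ s₂⇒b
corner-move⇒edge _ (s≤s ()) _ b′ s₁⇒b
corner-move⇒edge _ _ (s≤s ()) b′ s₂⇒b

bounds⇒iso : ∀ {x y z w} → x ≤ 1 → y ≤ 1 → z ≤ 1 → IsoToAssignmentGraph Down4 (corner x y z w t)
bounds⇒iso {x} {y} {z} {w} x≤1 y≤1 z≤1 =
  corner x y z w , reachable , corner-injective , surjective ,
  λ u v → mk⇔ (⟶⇒move ∘ edge⇒corner-move) (move⇒edge u v)
  where
  step : ∀ u {B} → Move Down4 (corner x y z w u) B → ∃[ v ] Down4 u v × corner x y z w v ≡ B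
  step u m = corner-move⇒edge x≤1 y≤1 z≤1 u (move⇒⟶ m)

  reachable : ∀ v → Reachable Down4 (corner x y z w t) (corner x y z w v)
  reachable t′ = ε
  reachable s₁′ = ⟶⇒move s₁⇒b ◅ ε
  reachable s₂′ = ⟶⇒move s₂⇒b ◅ ε
  reachable b′ = ⟶⇒move s₁⇒b ◅ ⟶⇒move s₂⇒b ◅ ε

  surjective : ∀ B → Reachable Down4 (corner x y z w t) B → ∃[ v ] corner x y z w v ≡ B
  surjective _ = image-closed-under-moves (corner x y z w) (λ {u} m → map₂ proj₂ (step u m)) {t}

  move⇒edge : ∀ u v → Move Down4 (corner x y z w u) (corner x y z w v) → Down4 u v
  move⇒edge u v m with step u m
  ... | v′ , e , corner-v′≡corner-v = subst (Down4 u) (corner-injective v′ v corner-v′≡corner-v) e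

corollary2p1 : (S : Assignment 4) →
    IsoToAssignmentGraph Down4 S ⇔
      (lookup S t ≤ 1
        × (2 ≤ lookup S s₁ × lookup S s₁ ≤ 3)
        × (2 ≤ lookup S s₂ × lookup S s₂ ≤ 3))
corollary2p1 (x ∷ y ∷ z ∷ w ∷ []) = mk⇔ (down4Shaped⇒bounds ∘ iso⇒down4Shaped) λ where
  (x≤1 , (s≤s (s≤s z≤n) , s≤s (s≤s y′≤1)) , (s≤s (s≤s z≤n) , s≤s (s≤s z′≤1))) → bounds⇒iso x≤1 y′≤1 z′≤1
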